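{- Let $G$ be a simple graph of order $n$ with $V(G)=\{v_1,\ldots,v_n\}$ and an integer eigenvalue $\lambda$ of $A(G)$ whose eigenspace is one-dimensional and spanned by a full vector $\mathbf{x}$. Let $(\Gamma_1,r_1),\ldots,(\Gamma_n,r_n)$ be undirected gadgets with $\operatorname{dem}(\Gamma_i,r_i)=\lambda$ for all $i$. Then the graph $M$ obtained from the disjoint union $G\sqcup\Gamma_1\sqcup\cdots\sqcup\Gamma_n$ by identifying $v_i$ with $r_i$ for all $i=1,\ldots,n$ (the merged vertex keeping all neighbours of both) is a nut graph.
   Context: For a simple graph $\Gamma$ with adjacency matrix $A(\Gamma)$ and a vertex $r$, $A(\Gamma)_{(r)}$ denotes $A(\Gamma)$ with the row indexed by $r$ deleted. A vector is full if it has no zero entry. An undirected gadget is a pair $(\Gamma,r)$, $\Gamma$ a simple graph and $r\in V(\Gamma)$ (the root), such that there is a full vector $\mathbf{z}$ spanning the (one-dimensional) kernel of $A(\Gamma)_{(r)}$; its demand is $\operatorname{dem}(\Gamma,r)=-\big(\sum_{u\sim r}\mathbf{z}(u)\big)/\mathbf{z}(r)$, the sum over neighbours $u$ of $r$ in $\Gamma$. A nut graph is a simple graph whose adjacency matrix has one-dimensional kernel spanned by a full vector. -}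

module Defs where

open import Data.Nat using (ℕ; zero; suc)
import Data.Nat as ℕ
open import Data.Fin using (Fin; zero; suc; splitAt)
open import Data.Bool using (Bool; true; false; if_then_else_)
open import Data.Integer using (ℤ)
open import Data.Rational using (ℚ; 0ℚ; _+_; _*_; -_; _÷_; _/_; ≢-nonZero)
open import Data.Product using (Σ; _,_; _×_; ∃; proj₁; proj₂)
open import Data.Sum using (inj₁; inj₂)
open import Relation.Binary.PropositionalEquality using (_≡_; _≢_; refl)

Σℚ : (n : ℕ) → (Fin n → ℚ) → ℚ
Σℚ zero    f = 0ℚ
Σℚ (suc n) f = f zero + Σℚ n (λ i → f (suc i))

record SimpleGraph (n : ℕ) : Set where
  field
    adj    : Fin n → Fin n → Bool
    sym    : ∀ u v → adj u v ≡ adj v u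
    irrefl : ∀ v → adj v v ≡ false
open SimpleGraph public

Vector : ℕ → Set
Vector n = Fin n → ℚ

Adjacency : ℕ → Set
Adjacency n = Fin n → Fin n → Bool

mulAdj : ∀ {n} → Adjacency n → Vector n → Vector n
mulAdj a x u = Σℚ _ (λ v → if a u v then x v else 0ℚ)

mulA : ∀ {n} → SimpleGraph n → Vector n → Vector n
mulA Γ = mulAdj (adj Γ)

Full : ∀ {n} → Vector n → Set
Full x = ∀ i → x i ≢ 0ℚ

OneDimSpannedBy : ∀ {n} → (Vector n → Set) → Vector n → Set
OneDimSpannedBy {n} S x =
  S x × (Σ (Fin n) λ i → x i ≢ 0ℚ) × (∀ y → S y → ∃ λ (c : ℚ) → ∀ i → y i ≡ c * x i)

InKernel : ∀ {n} → Adjacency n → Vector n → Set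
InKernel a x = ∀ u → mulAdj a x u ≡ 0ℚ

InEigenspace : ∀ {n} → SimpleGraph n → ℚ → Vector n → Set
InEigenspace Γ λ' x = ∀ u → mulA Γ x u ≡ λ' * x u

-- kernel of A(Γ)_(r): all rows except row r vanish
InKernelDel : ∀ {n} → SimpleGraph n → Fin n → Vector n → Set
InKernelDel Γ r x = ∀ u → u ≢ r → mulA Γ x u ≡ 0ℚ

IsNut : ∀ {n} → Adjacency n → Set
IsNut a = ∃ λ z → Full z × OneDimSpannedBy (InKernel a) z

record Gadget : Set where
  field
    order  : ℕ
    graph  : SimpleGraph order
    root   : Fin order
    vec    : Vector order
    full   : Full vec
    spans  : OneDimSpannedBy (InKernelDel graph root) vec
open Gadget public

dem : Gadget → ℚ
dem g = (- Σℚ (order g) (λ u → if adj (graph g) u (root g) then vec g u else 0ℚ))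
          ÷ vec g (root g)
  where instance _ = ≢-nonZero (full g (root g))

-- Vertices of M are pairs (i , u) with u ∈ V(Γ_i); the vertex (i , r_i)
-- is the vertex v_i = r_i after identification.

sumℕ : (n : ℕ) → (Fin n → ℕ) → ℕ
sumℕ zero    m = 0
sumℕ (suc n) m = m zero ℕ.+ sumℕ n (λ i → m (suc i))

decode : ∀ n (m : Fin n → ℕ) → Fin (sumℕ n m) → Σ (Fin n) (λ i → Fin (m i))
decode (suc n) m k with splitAt (m zero) k
... | inj₁ u = zero , u
... | inj₂ k' with decode n (λ i → m (suc i)) k'
...   | i , u = suc i , u

open import Data.Fin using (_≟_)
open import Relation.Nullary using (yes; no)
open import Data.Bool using (_∨_; _∧_)
import Relation.Nullary.Decidable as Dec

adjM : ∀ {n} (G : SimpleGraph n) (Γ : Fin n → Gadget) →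
       Σ (Fin n) (λ i → Fin (order (Γ i))) → Σ (Fin n) (λ i → Fin (order (Γ i))) → Bool
adjM G Γ (i , u) (j , w) with i ≟ j
... | yes refl = adj (graph (Γ i)) u w ∨ (Dec.⌊ u ≟ root (Γ i) ⌋ ∧ Dec.⌊ w ≟ root (Γ j) ⌋ ∧ adj G i j)
... | no _     = Dec.⌊ u ≟ root (Γ i) ⌋ ∧ Dec.⌊ w ≟ root (Γ j) ⌋ ∧ adj G i j

mergedOrder : ∀ {n} → (Fin n → Gadget) → ℕ
mergedOrder {n} Γ = sumℕ n (λ i → order (Γ i))

mergedAdj : ∀ {n} (G : SimpleGraph n) (Γ : Fin n → Gadget) → Adjacency (mergedOrder Γ)
mergedAdj {n} G Γ a b = adjM G Γ (decode n (λ i → order (Γ i)) a) (decode n (λ i → order (Γ i)) b)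

{-# OPTIONS --safe #-}
-- Write a vector on M as a family of vectors on the gadgets, glued at the roots. Away from the
-- roots, the row of A(M) at a vertex of Γᵢ only sees Γᵢ, so each block of a kernel vector of A(M)
-- lies in ker A(Γᵢ)_(rᵢ): it is a multiple of zᵢ, determined by its value at rᵢ. On such a block
-- the root row of A(Γᵢ) is -dem(Γᵢ,rᵢ) = -λ times the root value, and the row of A(M) at the
-- merged vertex vᵢ = rᵢ adds to it the row of A(G) on the root values; so the kernel condition
-- there says exactly that the root values form a λ-eigenvector of G. Hence restriction to the
-- roots is a bijection from ker A(M) onto the λ-eigenspace of G, and the full eigenvector x
-- extends to a full kernel vector spanning ker A(M).
module Submission where

open import Defs
import Data.Nat as ℕ
open import Data.Nat using (ℕ; zero; suc)
open import Data.Fin using (Fin; zero; suc; _↑ˡ_; _↑ʳ_; splitAt; join; _≟_)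
open import Data.Fin.Properties using (splitAt-↑ˡ; splitAt-↑ʳ; join-splitAt; suc-injective)
open import Data.Integer using (ℤ)
open import Data.Rational using (ℚ; 0ℚ; 1ℚ; _+_; _*_; -_; _/_; _÷_; 1/_; NonZero; ≢-nonZero)
open import Data.Rational.Properties
  using (+-identityˡ; +-identityʳ; +-inverseʳ; *-zeroˡ; *-zeroʳ; *-identityʳ; *-assoc;
         *-inverseˡ; *-distribˡ-+; +-0-group)
open import Algebra.Properties.Group +-0-group using (∙-cancelˡ)
open import Data.Rational.Solver using (module +-*-Solver)
open import Data.Bool using (Bool; true; false; if_then_else_; _∧_)
open import Data.Bool.Properties using (∧-zeroʳ; ∨-identityʳ)
open import Data.Product using (Σ; ∃; _,_; proj₁; proj₂)
open import Data.Sum using (inj₁; inj₂)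
open import Function using (_∘_)
open import Relation.Nullary using (yes; no; contradiction)
open import Relation.Nullary.Decidable using (⌊_⌋)
open import Relation.Binary.PropositionalEquality
  using (_≡_; _≢_; refl; trans; cong; cong₂; subst; module ≡-Reasoning)
  renaming (sym to ≡-sym)

open +-*-Solver
open ≡-Reasoning

÷-*-cancel : ∀ p q .{{_ : NonZero q}} → p ÷ q * q ≡ p
÷-*-cancel p q = begin
  p * 1/ q * q    ≡⟨ *-assoc p (1/ q) q ⟩
  p * (1/ q * q)  ≡⟨ cong (p *_) (*-inverseˡ q) ⟩
  p * 1ℚ          ≡⟨ *-identityʳ p ⟩
  p               ∎

÷-≢0 : ∀ {p} q .{{_ : NonZero q}} → p ≢ 0ℚ → p ÷ q ≢ 0ℚ
÷-≢0 {p} q p≢0 p÷q≡0 =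
  p≢0 (trans (≡-sym (÷-*-cancel p q)) (trans (cong (_* q) p÷q≡0) (*-zeroˡ q)))

*-≢0 : ∀ {p q} → p ≢ 0ℚ → q ≢ 0ℚ → p * q ≢ 0ℚ
*-≢0 {p} {q} p≢0 q≢0 pq≡0 = p≢0 (begin
  p              ≡⟨ ≡-sym (*-identityʳ p) ⟩
  p * 1ℚ         ≡⟨ cong (p *_) (≡-sym (*-inverseˡ q)) ⟩
  p * (1/ q * q) ≡⟨ solve 3 (λ p w q → p :* (w :* q) := (p :* q) :* w) refl p (1/ q) q ⟩
  p * q * 1/ q   ≡⟨ cong (_* 1/ q) pq≡0 ⟩
  0ℚ * 1/ q      ≡⟨ *-zeroˡ (1/ q) ⟩
  0ℚ             ∎)
  where
  instance
    q-nonZero : NonZero q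
    q-nonZero = ≢-nonZero q≢0

Σℚ-cong : ∀ n {f g : Fin n → ℚ} → (∀ i → f i ≡ g i) → Σℚ n f ≡ Σℚ n g
Σℚ-cong zero    f≗g = refl
Σℚ-cong (suc n) f≗g = cong₂ _+_ (f≗g zero) (Σℚ-cong n (f≗g ∘ suc))

Σℚ-zero : ∀ n {f : Fin n → ℚ} → (∀ i → f i ≡ 0ℚ) → Σℚ n f ≡ 0ℚ
Σℚ-zero zero    f≗0 = refl
Σℚ-zero (suc n) f≗0 = trans (cong₂ _+_ (f≗0 zero) (Σℚ-zero n (f≗0 ∘ suc))) (+-identityˡ 0ℚ)

Σℚ-distrib-+ : ∀ n (f g : Fin n → ℚ) → Σℚ n (λ i → f i + g i) ≡ Σℚ n f + Σℚ n g
Σℚ-distrib-+ zero    f g = ≡-sym (+-identityˡ 0ℚ)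
Σℚ-distrib-+ (suc n) f g =
  trans (cong (f zero + g zero +_) (Σℚ-distrib-+ n (f ∘ suc) (g ∘ suc)))
        (solve 4 (λ a b c d → (a :+ b) :+ (c :+ d) := (a :+ c) :+ (b :+ d)) refl
               (f zero) (g zero) (Σℚ n (f ∘ suc)) (Σℚ n (g ∘ suc)))

*-distribˡ-Σℚ : ∀ n c (f : Fin n → ℚ) → c * Σℚ n f ≡ Σℚ n (λ i → c * f i)
*-distribˡ-Σℚ zero    c f = *-zeroʳ c
*-distribˡ-Σℚ (suc n) c f =
  trans (*-distribˡ-+ c (f zero) _) (cong (c * f zero +_) (*-distribˡ-Σℚ n c (f ∘ suc)))

Σℚ-single : ∀ n (f : Fin n → ℚ) i → (∀ j → j ≢ i → f j ≡ 0ℚ) → Σℚ n f ≡ f i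
Σℚ-single (suc n) f zero f≗0 =
  trans (cong (f zero +_) (Σℚ-zero n (λ j → f≗0 (suc j) λ ()))) (+-identityʳ (f zero))
Σℚ-single (suc n) f (suc i) f≗0 =
  trans (cong (_+ Σℚ n (f ∘ suc)) (f≗0 zero λ ()))
        (trans (+-identityˡ _)
               (Σℚ-single n (f ∘ suc) i (λ j j≢i → f≗0 (suc j) (j≢i ∘ suc-injective))))

Σℚ-at : ∀ n i (b : Bool) (f : Fin n → ℚ) →
        Σℚ n (λ w → if ⌊ w ≟ i ⌋ ∧ b then f w else 0ℚ) ≡ (if b then f i else 0ℚ)
Σℚ-at n i b f = trans (Σℚ-single n _ i off) at-i
  where
  off : ∀ w → w ≢ i → (if ⌊ w ≟ i ⌋ ∧ b then f w else 0ℚ) ≡ 0ℚ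
  off w w≢i with w ≟ i
  ... | yes w≡i = contradiction w≡i w≢i
  ... | no _    = refl
  at-i : (if ⌊ i ≟ i ⌋ ∧ b then f i else 0ℚ) ≡ (if b then f i else 0ℚ)
  at-i with i ≟ i
  ... | yes _   = refl
  ... | no i≢i  = contradiction refl i≢i

Σℚ-↑ : ∀ a b (g : Fin (a ℕ.+ b) → ℚ) →
       Σℚ (a ℕ.+ b) g ≡ Σℚ a (λ u → g (u ↑ˡ b)) + Σℚ b (λ k → g (a ↑ʳ k))
Σℚ-↑ zero    b g = ≡-sym (+-identityˡ _)
Σℚ-↑ (suc a) b g =
  trans (cong (g zero +_) (Σℚ-↑ a b (g ∘ suc)))
        (solve 3 (λ x y z → x :+ (y :+ z) := (x :+ y) :+ z) refl (g zero) _ _)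

encode : ∀ n (m : Fin n → ℕ) → Σ (Fin n) (λ i → Fin (m i)) → Fin (sumℕ n m)
encode (suc n) m (zero  , u) = u ↑ˡ sumℕ n (m ∘ suc)
encode (suc n) m (suc i , u) = m zero ↑ʳ encode n (m ∘ suc) (i , u)

decode-encode : ∀ n m p → decode n m (encode n m p) ≡ p
decode-encode (suc n) m (zero , u)
  rewrite splitAt-↑ˡ (m zero) u (sumℕ n (m ∘ suc)) = refl
decode-encode (suc n) m (suc i , u)
  rewrite splitAt-↑ʳ (m zero) (sumℕ n (m ∘ suc)) (encode n (m ∘ suc) (i , u))
        | decode-encode n (m ∘ suc) (i , u) = refl

encode-decode : ∀ n m k → encode n m (decode n m k) ≡ k
encode-decode (suc n) m k with splitAt (m zero) k in eq
... | inj₁ u  = trans (cong (join (m zero) _) (≡-sym eq)) (join-splitAt (m zero) _ k)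
... | inj₂ k′ with decode n (m ∘ suc) k′ | encode-decode n (m ∘ suc) k′
...   | _ | ih = trans (cong (m zero ↑ʳ_) ih)
                       (trans (cong (join (m zero) _) (≡-sym eq)) (join-splitAt (m zero) _ k))

Σℚ-sumℕ : ∀ n m (g : Fin (sumℕ n m) → ℚ) →
          Σℚ (sumℕ n m) g ≡ Σℚ n (λ i → Σℚ (m i) (λ u → g (encode n m (i , u))))
Σℚ-sumℕ zero    m g = refl
Σℚ-sumℕ (suc n) m g =
  trans (Σℚ-↑ (m zero) _ g)
        (cong (Σℚ (m zero) (λ u → g (u ↑ˡ _)) +_) (Σℚ-sumℕ n (m ∘ suc) (g ∘ (m zero ↑ʳ_))))

mulAdj-cong : ∀ {k} (a : Adjacency k) {f g : Vector k} → (∀ w → f w ≡ g w) →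
              ∀ u → mulAdj a f u ≡ mulAdj a g u
mulAdj-cong a f≗g u = Σℚ-cong _ (λ w → cong (if a u w then_else 0ℚ) (f≗g w))

mulAdj-* : ∀ {k} (a : Adjacency k) c (f : Vector k) u →
           mulAdj a (λ w → c * f w) u ≡ c * mulAdj a f u
mulAdj-* {k} a c f u =
  trans (Σℚ-cong k (λ w → *-if (a u w) {f w}))
        (≡-sym (*-distribˡ-Σℚ k c (λ w → if a u w then f w else 0ℚ)))
  where
  *-if : ∀ b {v} → (if b then c * v else 0ℚ) ≡ c * (if b then v else 0ℚ)
  *-if true  = refl
  *-if false = ≡-sym (*-zeroʳ c)

inKernelDel-resp : ∀ {k} (Γ : SimpleGraph k) r {f g : Vector k} → (∀ w → f w ≡ g w) →
                   InKernelDel Γ r f → InKernelDel Γ r g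
inKernelDel-resp Γ r f≗g f∈ker u u≢r = trans (mulAdj-cong (adj Γ) (≡-sym ∘ f≗g) u) (f∈ker u u≢r)

inEigenspace-resp : ∀ {k} (Γ : SimpleGraph k) μ {f g : Vector k} → (∀ w → f w ≡ g w) →
                    InEigenspace Γ μ f → InEigenspace Γ μ g
inEigenspace-resp Γ μ f≗g f∈E u =
  trans (mulAdj-cong (adj Γ) (≡-sym ∘ f≗g) u) (trans (f∈E u) (cong (μ *_) (f≗g u)))

module _ (g : Gadget) where

  private
    instance
      root-nonZero : NonZero (vec g (root g))
      root-nonZero = ≢-nonZero (full g (root g))

    z : Vector (order g)
    z = vec g

    r : Fin (order g)
    r = root g

  dem*root≡-rootRow : dem g * z r ≡ - mulA (graph g) z r
  dem*root≡-rootRow = trans (÷-*-cancel _ (z r)) (cong -_ (Σℚ-cong (order g) column≡row))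
    where
    column≡row : ∀ u → (if adj (graph g) u r then z u else 0ℚ) ≡
                       (if adj (graph g) r u then z u else 0ℚ)
    column≡row u = cong (if_then z u else 0ℚ) (SimpleGraph.sym (graph g) u r)

  inKernelDel⇒rootRow : ∀ y → InKernelDel (graph g) r y → mulA (graph g) y r + dem g * y r ≡ 0ℚ
  inKernelDel⇒rootRow y y∈ker with proj₂ (proj₂ (spans g)) y y∈ker
  ... | d , y≡dz = begin
    mulA (graph g) y r + dem g * y r
      ≡⟨ cong₂ _+_ (trans (mulAdj-cong (adj (graph g)) y≡dz r) (mulAdj-* (adj (graph g)) d z r))
                   (cong (dem g *_) (y≡dz r)) ⟩
    d * mulA (graph g) z r + dem g * (d * z r)
      ≡⟨ solve 4 (λ d s e w → d :* s :+ e :* (d :* w) := d :* (s :+ e :* w))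
               refl d (mulA (graph g) z r) (dem g) (z r) ⟩
    d * (mulA (graph g) z r + dem g * z r)
      ≡⟨ cong (λ t → d * (mulA (graph g) z r + t)) dem*root≡-rootRow ⟩
    d * (mulA (graph g) z r + - mulA (graph g) z r)
      ≡⟨ cong (d *_) (+-inverseʳ (mulA (graph g) z r)) ⟩
    d * 0ℚ
      ≡⟨ *-zeroʳ d ⟩
    0ℚ ∎

  rootScaled : ℚ → Vector (order g)
  rootScaled a u = a ÷ z r * z u

  rootScaled-root : ∀ a → rootScaled a r ≡ a
  rootScaled-root a = ÷-*-cancel a (z r)

  rootScaled-* : ∀ c a u → rootScaled (c * a) u ≡ c * rootScaled a u
  rootScaled-* c a u =
    solve 4 (λ c a w z → c :* a :* w :* z := c :* (a :* w :* z)) refl c a (1/ z r) (z u)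

  rootScaled-full : ∀ {a} → a ≢ 0ℚ → Full (rootScaled a)
  rootScaled-full a≢0 u = *-≢0 (÷-≢0 (z r) a≢0) (full g u)

  rootScaled-inKernelDel : ∀ a → InKernelDel (graph g) r (rootScaled a)
  rootScaled-inKernelDel a u u≢r = begin
    mulA (graph g) (rootScaled a) u ≡⟨ mulAdj-* (adj (graph g)) (a ÷ z r) z u ⟩
    a ÷ z r * mulA (graph g) z u   ≡⟨ cong (a ÷ z r *_) (proj₁ (spans g) u u≢r) ⟩
    a ÷ z r * 0ℚ                   ≡⟨ *-zeroʳ (a ÷ z r) ⟩
    0ℚ                             ∎

  inKernelDel⇒rootScaled : ∀ y → InKernelDel (graph g) r y → ∀ u → y u ≡ rootScaled (y r) u
  inKernelDel⇒rootScaled y y∈ker u with proj₂ (proj₂ (spans g)) y y∈ker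
  ... | d , y≡dz = begin
    y u                     ≡⟨ y≡dz u ⟩
    d * z u                 ≡⟨ cong (_* z u) (≡-sym (rootScaled-root d)) ⟩
    d ÷ z r * z r * z u     ≡⟨ solve 4 (λ d w s t → d :* w :* s :* t := d :* s :* w :* t)
                                       refl d (1/ z r) (z r) (z u) ⟩
    rootScaled (d * z r) u  ≡⟨ cong (λ t → rootScaled t u) (≡-sym (y≡dz r)) ⟩
    rootScaled (y r) u      ∎

module Merged {n : ℕ} (G : SimpleGraph n) (Γ : Fin n → Gadget) where

  private
    sizes : Fin n → ℕ
    sizes i = order (Γ i)

    r : (i : Fin n) → Fin (sizes i)
    r i = root (Γ i)

    M : Adjacency (mergedOrder Γ)
    M = mergedAdj G Γ

  ⟪_⟫ : Σ (Fin n) (λ i → Fin (sizes i)) → Fin (mergedOrder Γ)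
  ⟪_⟫ = encode n sizes

  every-vertex : {P : Fin (mergedOrder Γ) → Set} → (∀ i u → P ⟪ i , u ⟫) → ∀ k → P k
  every-vertex {P} P⟪⟫ k = subst P (encode-decode n sizes k) (P⟪⟫ _ _)

  block : Vector (mergedOrder Γ) → (i : Fin n) → Vector (sizes i)
  block y i u = y ⟪ i , u ⟫

  atRoots : Vector (mergedOrder Γ) → Vector n
  atRoots y i = block y i (r i)

  glue : ((i : Fin n) → Vector (sizes i)) → Vector (mergedOrder Γ)
  glue Y k = Y (proj₁ (decode n sizes k)) (proj₂ (decode n sizes k))

  block-glue : ∀ Y i u → block (glue Y) i u ≡ Y i u
  block-glue Y i u = cong (λ (j , w) → Y j w) (decode-encode n sizes (i , u))

  private
    blockTerm rootTerm : Vector (mergedOrder Γ) → (i : Fin n) → Fin (sizes i) →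
                         (j : Fin n) → Fin (sizes j) → ℚ
    blockTerm y i u j w with i ≟ j
    ... | yes refl = if adj (graph (Γ i)) u w then block y i w else 0ℚ
    ... | no _     = 0ℚ

    rootTerm y i u j w = if ⌊ u ≟ r i ⌋ ∧ ⌊ w ≟ r j ⌋ ∧ adj G i j then block y j w else 0ℚ

    -- on the diagonal i = j the root–root edge would be a loop of G, which does not exist
    adjM-term : ∀ y i u j w → (if adjM G Γ (i , u) (j , w) then block y j w else 0ℚ) ≡
                              blockTerm y i u j w + rootTerm y i u j w
    adjM-term y i u j w with i ≟ j
    ... | no _ = ≡-sym (+-identityˡ _)
    ... | yes refl
      rewrite irrefl G i | ∧-zeroʳ ⌊ w ≟ r i ⌋ | ∧-zeroʳ ⌊ u ≟ r i ⌋
            | ∨-identityʳ (adj (graph (Γ i)) u w) = ≡-sym (+-identityʳ _)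

    Σ-blockTerm : ∀ y i u → Σℚ n (λ j → Σℚ (sizes j) (blockTerm y i u j)) ≡
                            mulA (graph (Γ i)) (block y i) u
    Σ-blockTerm y i u = trans (Σℚ-single n _ i off-diagonal) diagonal
      where
      off-diagonal : ∀ j → j ≢ i → Σℚ (sizes j) (blockTerm y i u j) ≡ 0ℚ
      off-diagonal j j≢i with i ≟ j
      ... | yes i≡j = contradiction (≡-sym i≡j) j≢i
      ... | no _    = Σℚ-zero (sizes j) (λ _ → refl)
      diagonal : Σℚ (sizes i) (blockTerm y i u i) ≡ mulA (graph (Γ i)) (block y i) u
      diagonal with i ≟ i
      ... | yes refl = refl
      ... | no i≢i   = contradiction refl i≢i

    Σ-rootTerm : ∀ y i u → Σℚ n (λ j → Σℚ (sizes j) (rootTerm y i u j)) ≡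
                           (if ⌊ u ≟ r i ⌋ then mulA G (atRoots y) i else 0ℚ)
    Σ-rootTerm y i u with u ≟ r i
    ... | yes _ = Σℚ-cong n (λ j → Σℚ-at (sizes j) (r j) (adj G i j) (block y j))
    ... | no _  = Σℚ-zero n (λ j → Σℚ-zero (sizes j) (λ _ → refl))

  mergedRow : ∀ y i u → mulAdj M y ⟪ i , u ⟫ ≡
              mulA (graph (Γ i)) (block y i) u + (if ⌊ u ≟ r i ⌋ then mulA G (atRoots y) i else 0ℚ)
  mergedRow y i u = begin
    mulAdj M y ⟪ i , u ⟫
      ≡⟨ Σℚ-sumℕ n sizes _ ⟩
    Σℚ n (λ j → Σℚ (sizes j) (λ w → if adjM G Γ (decode n sizes ⟪ i , u ⟫) (decode n sizes ⟪ j , w ⟫)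
                                      then block y j w else 0ℚ))
      ≡⟨ Σℚ-cong n (λ j → Σℚ-cong (sizes j) (λ w →
           trans (cong₂ (λ p q → if adjM G Γ p q then block y j w else 0ℚ)
                        (decode-encode n sizes (i , u)) (decode-encode n sizes (j , w)))
                 (adjM-term y i u j w))) ⟩
    Σℚ n (λ j → Σℚ (sizes j) (λ w → blockTerm y i u j w + rootTerm y i u j w))
      ≡⟨ Σℚ-cong n (λ j → Σℚ-distrib-+ (sizes j) _ _) ⟩
    Σℚ n (λ j → Σℚ (sizes j) (blockTerm y i u j) + Σℚ (sizes j) (rootTerm y i u j))
      ≡⟨ Σℚ-distrib-+ n _ _ ⟩
    Σℚ n (λ j → Σℚ (sizes j) (blockTerm y i u j)) + Σℚ n (λ j → Σℚ (sizes j) (rootTerm y i u j))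
      ≡⟨ cong₂ _+_ (Σ-blockTerm y i u) (Σ-rootTerm y i u) ⟩
    mulA (graph (Γ i)) (block y i) u + (if ⌊ u ≟ r i ⌋ then mulA G (atRoots y) i else 0ℚ) ∎

  mergedRow-nonroot : ∀ y i u → u ≢ r i → mulAdj M y ⟪ i , u ⟫ ≡ mulA (graph (Γ i)) (block y i) u
  mergedRow-nonroot y i u u≢r with mergedRow y i u
  ... | row with u ≟ r i
  ...   | yes u≡r = contradiction u≡r u≢r
  ...   | no _    = trans row (+-identityʳ _)

  mergedRow-root : ∀ y i → mulAdj M y ⟪ i , r i ⟫ ≡
                           mulA (graph (Γ i)) (block y i) (r i) + mulA G (atRoots y) i
  mergedRow-root y i with mergedRow y i (r i)
  ... | row with r i ≟ r i
  ...   | yes _   = row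
  ...   | no r≢r  = contradiction refl r≢r

  extend : Vector n → Vector (mergedOrder Γ)
  extend x = glue (λ i → rootScaled (Γ i) (x i))

  block-extend : ∀ x i u → block (extend x) i u ≡ rootScaled (Γ i) (x i) u
  block-extend x = block-glue (λ i → rootScaled (Γ i) (x i))

  extend-full : ∀ {x} → Full x → Full (extend x)
  extend-full x-full k = rootScaled-full (Γ _) (x-full _) _

  extend-cong : ∀ {x x′} → (∀ i → x i ≡ x′ i) → ∀ k → extend x k ≡ extend x′ k
  extend-cong x≗x′ k = cong (λ a → rootScaled (Γ (proj₁ v)) a (proj₂ v)) (x≗x′ (proj₁ v))
    where
    v : Σ (Fin n) (λ i → Fin (sizes i))
    v = decode n sizes k

  extend-* : ∀ c x k → extend (λ i → c * x i) k ≡ c * extend x k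
  extend-* c x k = rootScaled-* (Γ _) c (x _) _

module _ {n : ℕ} (G : SimpleGraph n) (Γ : Fin n → Gadget) {λ′ : ℚ}
         (dem≡λ : ∀ i → dem (Γ i) ≡ λ′) where

  open Merged G Γ

  private
    M : Adjacency (mergedOrder Γ)
    M = mergedAdj G Γ

  inKernel⁺ : ∀ y → (∀ i → InKernelDel (graph (Γ i)) (root (Γ i)) (block y i)) →
              InEigenspace G λ′ (atRoots y) → InKernel M y
  inKernel⁺ y blocks∈ker roots∈E = every-vertex row≡0
    where
    row≡0 : ∀ i u → mulAdj M y ⟪ i , u ⟫ ≡ 0ℚ
    row≡0 i u with u ≟ root (Γ i)
    ... | no u≢r   = trans (mergedRow-nonroot y i u u≢r) (blocks∈ker i u u≢r)
    ... | yes refl = begin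
      mulAdj M y ⟪ i , root (Γ i) ⟫
        ≡⟨ mergedRow-root y i ⟩
      mulA (graph (Γ i)) (block y i) (root (Γ i)) + mulA G (atRoots y) i
        ≡⟨ cong (mulA (graph (Γ i)) (block y i) (root (Γ i)) +_)
                (trans (roots∈E i) (cong (_* atRoots y i) (≡-sym (dem≡λ i)))) ⟩
      mulA (graph (Γ i)) (block y i) (root (Γ i)) + dem (Γ i) * atRoots y i
        ≡⟨ inKernelDel⇒rootRow (Γ i) (block y i) (blocks∈ker i) ⟩
      0ℚ ∎

  inKernel⇒blocks : ∀ y → InKernel M y → ∀ i → InKernelDel (graph (Γ i)) (root (Γ i)) (block y i)
  inKernel⇒blocks y y∈ker i u u≢r = trans (≡-sym (mergedRow-nonroot y i u u≢r)) (y∈ker ⟪ i , u ⟫)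

  inKernel⇒atRoots : ∀ y → InKernel M y → InEigenspace G λ′ (atRoots y)
  inKernel⇒atRoots y y∈ker i = ∙-cancelˡ rootRow _ _ (trans with-G (≡-sym with-dem))
    where
    rootRow : ℚ
    rootRow = mulA (graph (Γ i)) (block y i) (root (Γ i))
    with-G : rootRow + mulA G (atRoots y) i ≡ 0ℚ
    with-G = trans (≡-sym (mergedRow-root y i)) (y∈ker ⟪ i , root (Γ i) ⟫)
    with-dem : rootRow + λ′ * atRoots y i ≡ 0ℚ
    with-dem = trans (cong (λ μ → rootRow + μ * atRoots y i) (≡-sym (dem≡λ i)))
                     (inKernelDel⇒rootRow (Γ i) (block y i) (inKernel⇒blocks y y∈ker i))

  inKernel⇒extend-atRoots : ∀ y → InKernel M y → ∀ k → y k ≡ extend (atRoots y) k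
  inKernel⇒extend-atRoots y y∈ker = every-vertex λ i u →
    trans (inKernelDel⇒rootScaled (Γ i) (block y i) (inKernel⇒blocks y y∈ker i) u)
          (≡-sym (block-extend (atRoots y) i u))

  extend-inKernel : ∀ x → InEigenspace G λ′ x → InKernel M (extend x)
  extend-inKernel x x∈E = inKernel⁺ (extend x) blocks∈ker roots∈E
    where
    blocks∈ker : ∀ i → InKernelDel (graph (Γ i)) (root (Γ i)) (block (extend x) i)
    blocks∈ker i = inKernelDel-resp (graph (Γ i)) (root (Γ i)) (≡-sym ∘ block-extend x i)
                                    (rootScaled-inKernelDel (Γ i) (x i))
    roots∈E : InEigenspace G λ′ (atRoots (extend x))
    roots∈E = inEigenspace-resp G λ′
                (λ i → ≡-sym (trans (block-extend x i (root (Γ i))) (rootScaled-root (Γ i) (x i)))) x∈E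

  extend-spans : ∀ x → Full x → OneDimSpannedBy (InEigenspace G λ′) x →
                 OneDimSpannedBy (InKernel M) (extend x)
  extend-spans x x-full (x∈E , (i₀ , _) , x-spans) =
    extend-inKernel x x∈E , (v₀ , extend-full x-full v₀) , kernel⊆span
    where
    v₀ : Fin (mergedOrder Γ)
    v₀ = ⟪ i₀ , root (Γ i₀) ⟫
    kernel⊆span : ∀ y → InKernel M y → ∃ λ C → ∀ k → y k ≡ C * extend x k
    kernel⊆span y y∈ker = C , λ k → begin
      y k                          ≡⟨ inKernel⇒extend-atRoots y y∈ker k ⟩
      extend (atRoots y) k         ≡⟨ extend-cong roots≡Cx k ⟩
      extend (λ i → C * x i) k     ≡⟨ extend-* C x k ⟩
      C * extend x k               ∎
      where
      C : ℚ
      C = proj₁ (x-spans (atRoots y) (inKernel⇒atRoots y y∈ker))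
      roots≡Cx : ∀ i → atRoots y i ≡ C * x i
      roots≡Cx = proj₂ (x-spans (atRoots y) (inKernel⇒atRoots y y∈ker))

theorem41 : (n : ℕ) (G : SimpleGraph n) (λ' : ℤ) (x : Vector n) →
            Full x → OneDimSpannedBy (InEigenspace G (λ' / 1)) x →
            (Γ : Fin n → Gadget) → (∀ i → dem (Γ i) ≡ λ' / 1) →
            IsNut (mergedAdj G Γ)
theorem41 n G λ' x x-full x-spans Γ dem≡λ =
  extend x , extend-full x-full , extend-spans G Γ dem≡λ x x-full x-spans
  where open Merged G Γ
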